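{- Let $p\ge2$ and $w\ge1$ be integers and $\zeta\in(0,1]$. Let $A_1,\dots,A_p$ be finite sets such that any two of them are either disjoint or equal; let $A_1^*,\dots,A_\rho^*$ be the distinct sets among them, where $A_i^*$ occurs exactly $l_i$ times in the sequence $A_1,\dots,A_p$. Let $S_1,\dots,S_q$ be pairwise different sets with $|S_i|=p$, $S_i=\{s_i^{(1)},\dots,s_i^{(p)}\}$ and $s_i^{(j)}\in A_j$ for all $i\in[q]$, $j\in[p]$. Suppose $$q\ge 2\sum_{\omega=\lceil\zeta p\rceil}^{p}\frac{(pw)^\omega}{\omega!}\sum_{\substack{n_1+\dots+n_\rho=p-\omega\\ n_i\le l_i}}\frac{|A_1^*|^{n_1}\cdots|A_\rho^*|^{n_\rho}}{n_1!\cdots n_\rho!}.$$ Then there are sets $S_{n_1},\dots,S_{n_w}$ from the sequence $S_1,\dots,S_q$ such that for every $l=2,\dots,w$, $\big|\big(\bigcup_{i=1}^{l-1}S_{n_i}\big)\cap S_{n_l}\big|\le\zeta p$.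
   Context: The $n_i$ in the inner sum range over nonnegative integers.
   Formalization: The parameter ζ ranges over the rationals in (0,1] instead of the reals. -}

module Defs where

open import Data.Nat as ℕ using (ℕ; zero; suc; _∸_; _!; _^_)
open import Data.Nat.Properties using (_!≢0)
open import Data.Integer as ℤ using (ℤ; +_)
open import Data.Rational as ℚ using (ℚ; 0ℚ; 1ℚ; ceiling; _/_)
open import Data.Fin as Fin using (Fin; toℕ)
open import Data.Fin.Subset using (Subset; ⋃; ∣_∣)
open import Data.List as List using (List; []; _∷_; upTo; allFin; filter; map)
open import Data.Vec as Vec using (Vec; tabulate)
open import Data.Bool.ListAction using (any)
open import Data.Vec.Properties using (≡-dec)
open import Data.Bool using (Bool; true; false; if_then_else_)
import Data.Bool.Properties as BoolP
open import Relation.Nullary using (does)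
open import Relation.Binary.PropositionalEquality using (_≡_)
open import Relation.Binary using (DecidableEquality)
open import Data.Product using (_×_; _,_)

_≟ₛ_ : ∀ {N} → DecidableEquality (Subset N)
_≟ₛ_ = ≡-dec BoolP._≟_

occurrences : ∀ {p N} → (Fin p → Subset N) → Subset N → ℕ
occurrences A B = List.length (filter (λ j → A j ≟ₛ B) (allFin _))

-- the set {s(1), ..., s(p)} as a subset of Fin N
image : ∀ {p N} → (Fin p → Fin N) → Subset N
image s = tabulate (λ x → any (λ j → does (s j Fin.≟ x)) (allFin _))

prefixUnion : ∀ {w N} → (Fin w → Subset N) → Fin w → Subset N
prefixUnion F l = ⋃ (map F (filter (λ i → toℕ i ℕ.<? toℕ l) (allFin _)))

sumℚ : List ℚ → ℚ
sumℚ = List.foldr ℚ._+_ 0ℚ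

powFact : ℕ → ℕ → ℚ
powFact a n = (+ (a ^ n) / (n !)) {{n !≢0}}

-- sum over (n_1,...,n_ρ) with n_1+...+n_ρ = m and n_i ≤ l_i of
--   prod_i |A_i*|^{n_i} / n_i!
-- where the list holds the pairs (|A_i*|, l_i)
innerSum : List (ℕ × ℕ) → ℕ → ℚ
innerSum [] zero = 1ℚ
innerSum [] (suc _) = 0ℚ
innerSum ((a , l) ∷ rest) m =
  sumℚ (map (λ n → if does (n ℕ.≤? l) ∧ does (n ℕ.≤? m)
                   then powFact a n ℚ.* innerSum rest (m ∸ n) else 0ℚ)
            (upTo (suc m)))
  where open import Data.Bool using (_∧_)

distinctData : ∀ {p N ρ} → (Fin p → Subset N) → (Fin ρ → Subset N) → List (ℕ × ℕ)
distinctData A Astar = map (λ i → (∣ Astar i ∣ , occurrences A (Astar i))) (allFin _)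

bound : (p w : ℕ) → ℚ → List (ℕ × ℕ) → ℚ
bound p w ζ dat =
  (+ 2 / 1) ℚ.* sumℚ (map (λ ω → if does (ceiling (ζ ℚ.* (+ p / 1)) ℤ.≤? + ω)
                                 then powFact (p ℕ.* w) ω ℚ.* innerSum dat (p ∸ ω) else 0ℚ)
                          (upTo (suc p)))

{-# OPTIONS --safe #-}

-- The sets are chosen greedily. Once k < w of them are chosen, their union U has at most pw
-- points. A set S = {s(1), …, s(p)} with |U ∩ S| = ω > ζp is the union of the ω-subset U ∩ S
-- of U and of S ─ U, a (p − ω)-set meeting each A*ᵢ in at most lᵢ points (as the A_j are
-- equal or disjoint, s(j) ∈ A*ᵢ forces A_j = A*ᵢ). Hence at most Σ_{ω ≥ ⌈ζp⌉} C(pw, ω) I(p − ω)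
-- sets are too heavy, I counting the sets of the second kind; as C(a, n) ≤ aⁿ/n!, this is at
-- most half the bound on q. The term ω = p alone is C(pw, p) ≥ w > k, so fewer than q
-- indices are heavy or already chosen, and the greedy choice can continue.
module Submission where

open import Defs
open import Data.Nat using (ℕ; _≤_)
open import Data.Fin using (Fin; toℕ)
open import Data.Fin.Subset using (Subset; _∈_; _∩_; ∣_∣; ⊥)
open import Data.Product using (∃; _×_; _,_)
open import Data.Sum using (_⊎_)
open import Function using (_∘_)
open import Function.Definitions using (Injective)
open import Relation.Binary.PropositionalEquality using (_≡_)

module Subsets where

  open import Data.Nat using (suc; _+_; _*_; z≤n; s≤s)
  open import Data.Nat.Properties
  open import Data.Vec using ([]; _∷_; here; there)
  open import Data.Bool using (T)
  open import Data.Unit using (tt)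
  open import Data.Fin as Fin using (zero; suc)
  open import Data.Fin.Subset
  open import Data.Fin.Subset.Properties using (x∈p∪q⁺; ∣⊥∣≡0)
  open import Data.List using ([]; _∷_; map; length; allFin)
  open import Data.List.Membership.Propositional using () renaming (_∈_ to _∈ₗ_)
  open import Data.List.Relation.Unary.Any using (here; there)
  open import Data.List.Relation.Unary.Any.Properties using (any⁻; tabulate⁻)
  open import Data.Sum using (inj₁; inj₂)
  open import Data.Vec.Properties using ([]=⇒lookup; lookup∘tabulate)
  open import Relation.Binary.PropositionalEquality
  open import Relation.Nullary using (does; yes)

  ∣p∪q∣≤∣p∣+∣q∣ : ∀ {n} (p q : Subset n) → ∣ p ∪ q ∣ ≤ ∣ p ∣ + ∣ q ∣
  ∣p∪q∣≤∣p∣+∣q∣ []            []            = z≤n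
  ∣p∪q∣≤∣p∣+∣q∣ (inside  ∷ p) (inside  ∷ q) =
    s≤s (≤-trans (∣p∪q∣≤∣p∣+∣q∣ p q) (+-monoʳ-≤ ∣ p ∣ (n≤1+n _)))
  ∣p∪q∣≤∣p∣+∣q∣ (inside  ∷ p) (outside ∷ q) = s≤s (∣p∪q∣≤∣p∣+∣q∣ p q)
  ∣p∪q∣≤∣p∣+∣q∣ (outside ∷ p) (inside  ∷ q) =
    ≤-trans (s≤s (∣p∪q∣≤∣p∣+∣q∣ p q)) (≤-reflexive (sym (+-suc ∣ p ∣ ∣ q ∣)))
  ∣p∪q∣≤∣p∣+∣q∣ (outside ∷ p) (outside ∷ q) = ∣p∪q∣≤∣p∣+∣q∣ p q

  ∣p∣≡∣q∩p∣+∣p─q∣ : ∀ {n} (p q : Subset n) → ∣ p ∣ ≡ ∣ q ∩ p ∣ + ∣ p ─ q ∣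
  ∣p∣≡∣q∩p∣+∣p─q∣ []            []            = refl
  ∣p∣≡∣q∩p∣+∣p─q∣ (inside  ∷ p) (inside  ∷ q) = cong suc (∣p∣≡∣q∩p∣+∣p─q∣ p q)
  ∣p∣≡∣q∩p∣+∣p─q∣ (inside  ∷ p) (outside ∷ q) =
    trans (cong suc (∣p∣≡∣q∩p∣+∣p─q∣ p q)) (sym (+-suc _ _))
  ∣p∣≡∣q∩p∣+∣p─q∣ (outside ∷ p) (inside  ∷ q) = ∣p∣≡∣q∩p∣+∣p─q∣ p q
  ∣p∣≡∣q∩p∣+∣p─q∣ (outside ∷ p) (outside ∷ q) = ∣p∣≡∣q∩p∣+∣p─q∣ p q

  p≡[q∩p]∪[p─q] : ∀ {n} (p q : Subset n) → p ≡ (q ∩ p) ∪ (p ─ q)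
  p≡[q∩p]∪[p─q] []            []            = refl
  p≡[q∩p]∪[p─q] (inside  ∷ p) (inside  ∷ q) = cong (inside ∷_) (p≡[q∩p]∪[p─q] p q)
  p≡[q∩p]∪[p─q] (inside  ∷ p) (outside ∷ q) = cong (inside ∷_) (p≡[q∩p]∪[p─q] p q)
  p≡[q∩p]∪[p─q] (outside ∷ p) (inside  ∷ q) = cong (outside ∷_) (p≡[q∩p]∪[p─q] p q)
  p≡[q∩p]∪[p─q] (outside ∷ p) (outside ∷ q) = cong (outside ∷_) (p≡[q∩p]∪[p─q] p q)

  x∈p─q⇒x∉q : ∀ {n} {x : Fin n} (p q : Subset n) → x ∈ p ─ q → x ∉ q
  x∈p─q⇒x∉q {x = zero}  (_ ∷ p) (outside ∷ q) _          ()
  x∈p─q⇒x∉q {x = suc x} (_ ∷ p) (_       ∷ q) (there x∈p─q) (there x∈q) =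
    x∈p─q⇒x∉q p q x∈p─q x∈q

  x∈⋃⁺ : ∀ {n} {x : Fin n} {p : Subset n} {ps} → p ∈ₗ ps → x ∈ p → x ∈ ⋃ ps
  x∈⋃⁺ (here refl)  x∈p = x∈p∪q⁺ (inj₁ x∈p)
  x∈⋃⁺ (there p∈ps) x∈p = x∈p∪q⁺ (inj₂ (x∈⋃⁺ p∈ps x∈p))

  ∣⋃map∣≤length* : ∀ {n} {A : Set} (F : A → Subset n) {c} → (∀ a → ∣ F a ∣ ≤ c) →
                   ∀ xs → ∣ ⋃ (map F xs) ∣ ≤ length xs * c
  ∣⋃map∣≤length* {n} F ∣F∣≤c []       = ≤-reflexive (∣⊥∣≡0 n)
  ∣⋃map∣≤length* F ∣F∣≤c (x ∷ xs) =
    ≤-trans (∣p∪q∣≤∣p∣+∣q∣ (F x) _)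
            (+-mono-≤ (∣F∣≤c x) (∣⋃map∣≤length* F ∣F∣≤c xs))

  ∈-image⁻ : ∀ {n m} {t : Fin n → Fin m} {x} → x ∈ image t → ∃ λ j → t j ≡ x
  ∈-image⁻ {n} {t = t} {x} x∈image =
    some-j≡ (tabulate⁻ (any⁻ _ (allFin n) (subst T (sym any≡true) tt)))
    where
    any≡true = trans (sym (lookup∘tabulate _ x)) ([]=⇒lookup x∈image)
    some-j≡ : (∃ λ j → T (does (t j Fin.≟ x))) → ∃ λ j → t j ≡ x
    some-j≡ (j , t[j]≟x) with t j Fin.≟ x | t[j]≟x
    ... | yes t[j]≡x | _ = j , t[j]≡x

module Binomial where

  open import Data.Nat using (zero; suc; _+_; _*_; _∸_; _^_; _!; _≤′_; ≤′-refl; ≤′-step; z≤n)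
  open import Data.Nat.Properties
  open import Data.Nat.Combinatorics using (_C_; nCk+nC[k+1]≡[n+1]C[k+1]; nC1≡n)
  open import Data.Nat.Solver using (module +-*-Solver)
  open import Relation.Binary.PropositionalEquality
  open +-*-Solver
  open ≤-Reasoning

  pascal : ∀ m k → suc m C suc k ≡ m C k + m C suc k
  pascal m k = sym (nCk+nC[k+1]≡[n+1]C[k+1] m k)

  C≤sucC : ∀ m k → m C k ≤ suc m C k
  C≤sucC m zero    = ≤-refl
  C≤sucC m (suc k) = ≤-trans (m≤n+m (m C suc k) (m C k)) (≤-reflexive (sym (pascal m k)))

  C-monoˡ-≤ : ∀ {m n} k → m ≤ n → m C k ≤ n C k
  C-monoˡ-≤ {m} k m≤n = go (≤⇒≤′ m≤n)
    where
    go : ∀ {n} → m ≤′ n → m C k ≤ n C k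
    go ≤′-refl        = ≤-refl
    go (≤′-step m≤′n) = ≤-trans (go m≤′n) (C≤sucC _ k)

  C-diagonal : ∀ j m k → m C k ≤ (j + m) C (j + k)
  C-diagonal zero    m k = ≤-refl
  C-diagonal (suc j) m k = begin
    m C k                                            ≤⟨ C-diagonal j m k ⟩
    (j + m) C (j + k)                                ≤⟨ m≤m+n _ _ ⟩
    (j + m) C (j + k) + (j + m) C suc (j + k)        ≡⟨ pascal (j + m) (j + k) ⟨
    suc (j + m) C suc (j + k)                        ∎

  w≤[p*w]Cp : ∀ p w → 1 ≤ p → w ≤ (p * w) C p
  w≤[p*w]Cp p       zero    _ = z≤n
  w≤[p*w]Cp (suc p) (suc w) _ = begin
    suc w                          ≤⟨ m+n≤o⇒m≤o∸n (suc w) w+p≤P ⟩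
    P ∸ p                          ≡⟨ nC1≡n (P ∸ p) ⟨
    (P ∸ p) C 1                    ≤⟨ C-diagonal p (P ∸ p) 1 ⟩
    (p + (P ∸ p)) C (p + 1)        ≡⟨ cong₂ _C_ (m+[n∸m]≡n p≤P) (+-comm p 1) ⟩
    P C suc p                      ∎
    where
    P = suc p * suc w
    w+p≤P : suc w + p ≤ P
    w+p≤P = +-monoʳ-≤ (suc w) (m≤m*n p (suc w))
    p≤P : p ≤ P
    p≤P = m+n≤o⇒n≤o (suc w) w+p≤P

  m^[1+k]+[1+k]*m^k≤[1+m]^[1+k] : ∀ m k → m ^ suc k + suc k * m ^ k ≤ suc m ^ suc k
  m^[1+k]+[1+k]*m^k≤[1+m]^[1+k] m zero    = ≤-reflexive (+-comm (m * 1) 1)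
  m^[1+k]+[1+k]*m^k≤[1+m]^[1+k] m (suc k) = begin
    m ^ suc (suc k) + suc (suc k) * m ^ suc k                   ≤⟨ m≤m+n _ _ ⟩
    m ^ suc (suc k) + suc (suc k) * m ^ suc k + suc k * m ^ k   ≡⟨ expand m (m ^ k) k ⟩
    suc m * (m ^ suc k + suc k * m ^ k)                         ≤⟨ *-monoʳ-≤ (suc m) ih ⟩
    suc m ^ suc (suc k)                                         ∎
    where
    ih = m^[1+k]+[1+k]*m^k≤[1+m]^[1+k] m k
    expand : ∀ m b k → m * (m * b) + (2 + k) * (m * b) + (1 + k) * b ≡ (1 + m) * (m * b + (1 + k) * b)
    expand = solve 3 (λ m b k → m :* (m :* b) :+ (con 2 :+ k) :* (m :* b) :+ (con 1 :+ k) :* b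
                              := (con 1 :+ m) :* (m :* b :+ (con 1 :+ k) :* b)) refl

  mCk*k!≤m^k : ∀ m k → (m C k) * k ! ≤ m ^ k
  mCk*k!≤m^k m       zero    = ≤-refl
  mCk*k!≤m^k zero    (suc k) = z≤n
  mCk*k!≤m^k (suc m) (suc k) = begin
    (suc m C suc k) * (suc k * k !)                        ≡⟨ cong (_* (suc k * k !)) (pascal m k) ⟩
    (m C k + m C suc k) * (suc k * k !)                    ≡⟨ rearrange (m C k) (m C suc k) k (k !) ⟩
    (m C suc k) * (suc k * k !) + suc k * ((m C k) * k !)  ≤⟨ +-mono-≤ ih₁ (*-monoʳ-≤ (suc k) ih₂) ⟩
    m ^ suc k + suc k * m ^ k                              ≤⟨ m^[1+k]+[1+k]*m^k≤[1+m]^[1+k] m k ⟩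
    suc m ^ suc k                                          ∎
    where
    ih₁ = mCk*k!≤m^k m (suc k)
    ih₂ = mCk*k!≤m^k m k
    rearrange : ∀ a b k f → (a + b) * ((1 + k) * f) ≡ b * ((1 + k) * f) + (1 + k) * (a * f)
    rearrange = solve 4 (λ a b k f → (a :+ b) :* ((con 1 :+ k) :* f)
                                  := b :* ((con 1 :+ k) :* f) :+ (con 1 :+ k) :* (a :* f)) refl

module Enumeration where

  open import Data.Nat using (zero; suc; _+_; _*_; _∸_; _≤?_; s≤s)
  open import Data.Nat.Properties using (m+n∸m≡n; ≤-trans)
  open import Data.Nat.ListAction using (sum)
  open import Data.Nat.Combinatorics using (_C_; nCk+nC[k+1]≡[n+1]C[k+1])
  open import Data.Bool using (true; false; if_then_else_; _∧_)
  open import Data.Vec using ([]; _∷_; here)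
  open import Data.Fin.Subset
  open import Data.Fin.Subset.Properties
    using (Empty-unique; ∣⊥∣≡0; x∈p∩q⁺; x∈p∩q⁻; p∩q⊆p; p⊆q⇒∣p∣≤∣q∣; p─q⊆p; ∣p∩q∣≤∣q∣;
           drop-∷-⊆)
  open import Data.List using (List; []; _∷_; map; _++_; length; concat; cartesianProductWith; upTo)
  open import Data.List.Properties using (length-map; length-++; map-∘; map-cong)
  open import Data.List.Membership.Propositional using () renaming (_∈_ to _∈ₗ_)
  open import Data.List.Membership.Propositional.Properties
    using (∈-map⁺; ∈-++⁺ˡ; ∈-++⁺ʳ; ∈-concat⁺′; ∈-cartesianProductWith⁺; ∈-upTo⁺)
  open import Data.List.Relation.Unary.Any using (Any; here; there)
  open import Data.List.Relation.Unary.All as All using (All; _∷_)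
  open import Data.List.Relation.Unary.Any.Properties using (¬Any[])
  open import Data.Product using (proj₁; proj₂; map₁)
  open import Relation.Binary.PropositionalEquality
  open import Relation.Nullary using (does; contradiction)
  open import Relation.Nullary.Decidable using (dec-true)
  open Subsets

  length-concat : ∀ {A : Set} (xss : List (List A)) → length (concat xss) ≡ sum (map length xss)
  length-concat []         = refl
  length-concat (xs ∷ xss) = trans (length-++ xs) (cong (length xs +_) (length-concat xss))

  length-cartesianProductWith : ∀ {A B C : Set} (f : A → B → C) xs ys →
                                length (cartesianProductWith f xs ys) ≡ length xs * length ys
  length-cartesianProductWith f []       ys = refl
  length-cartesianProductWith f (x ∷ xs) ys =
    trans (length-++ (map (f x) ys)) (cong₂ _+_ (length-map (f x) ys) (length-cartesianProductWith f xs ys))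

  subsetsOfSize : ∀ {n} → Subset n → ℕ → List (Subset n)
  subsetsOfSize []            zero    = [] ∷ []
  subsetsOfSize []            (suc k) = []
  subsetsOfSize (outside ∷ B) k       = map (outside ∷_) (subsetsOfSize B k)
  subsetsOfSize (inside  ∷ B) zero    = map (outside ∷_) (subsetsOfSize B zero)
  subsetsOfSize (inside  ∷ B) (suc k) =
    map (inside ∷_) (subsetsOfSize B k) ++ map (outside ∷_) (subsetsOfSize B (suc k))

  length-subsetsOfSize : ∀ {n} (B : Subset n) k → length (subsetsOfSize B k) ≡ ∣ B ∣ C k
  length-subsetsOfSize []            zero    = refl
  length-subsetsOfSize []            (suc k) = refl
  length-subsetsOfSize (outside ∷ B) k       =
    trans (length-map _ (subsetsOfSize B k)) (length-subsetsOfSize B k)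
  length-subsetsOfSize (inside  ∷ B) zero    =
    trans (length-map _ (subsetsOfSize B zero)) (length-subsetsOfSize B zero)
  length-subsetsOfSize (inside  ∷ B) (suc k) = begin
    length (map (inside ∷_) (subsetsOfSize B k) ++ map (outside ∷_) (subsetsOfSize B (suc k)))
      ≡⟨ length-++ (map (inside ∷_) (subsetsOfSize B k)) ⟩
    length (map (inside ∷_) (subsetsOfSize B k)) + length (map (outside ∷_) (subsetsOfSize B (suc k)))
      ≡⟨ cong₂ _+_ (length-map _ (subsetsOfSize B k)) (length-map _ (subsetsOfSize B (suc k))) ⟩
    length (subsetsOfSize B k) + length (subsetsOfSize B (suc k))
      ≡⟨ cong₂ _+_ (length-subsetsOfSize B k) (length-subsetsOfSize B (suc k)) ⟩
    ∣ B ∣ C k + ∣ B ∣ C suc k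
      ≡⟨ nCk+nC[k+1]≡[n+1]C[k+1] ∣ B ∣ k ⟩
    suc ∣ B ∣ C suc k
      ∎
    where open ≡-Reasoning

  outside∷-∈-subsetsOfSize : ∀ {n} (B : Subset n) k {X} → X ∈ₗ subsetsOfSize B k →
                              (outside ∷ X) ∈ₗ subsetsOfSize (inside ∷ B) k
  outside∷-∈-subsetsOfSize B zero    X∈ = ∈-map⁺ _ X∈
  outside∷-∈-subsetsOfSize B (suc k) X∈ =
    ∈-++⁺ʳ (map (inside ∷_) (subsetsOfSize B k)) (∈-map⁺ _ X∈)

  ⊆⇒∈-subsetsOfSize : ∀ {n} {X B : Subset n} → X ⊆ B → X ∈ₗ subsetsOfSize B ∣ X ∣
  ⊆⇒∈-subsetsOfSize {X = []}          {[]}          X⊆B = here refl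
  ⊆⇒∈-subsetsOfSize {X = outside ∷ X} {outside ∷ B} X⊆B =
    ∈-map⁺ _ (⊆⇒∈-subsetsOfSize (drop-∷-⊆ X⊆B))
  ⊆⇒∈-subsetsOfSize {X = inside  ∷ X} {outside ∷ B} X⊆B with () ← X⊆B here
  ⊆⇒∈-subsetsOfSize {X = outside ∷ X} {inside  ∷ B} X⊆B =
    outside∷-∈-subsetsOfSize B ∣ X ∣ (⊆⇒∈-subsetsOfSize (drop-∷-⊆ X⊆B))
  ⊆⇒∈-subsetsOfSize {X = inside  ∷ X} {inside  ∷ B} X⊆B =
    ∈-++⁺ˡ (∈-map⁺ _ (⊆⇒∈-subsetsOfSize (drop-∷-⊆ X⊆B)))

  -- selections [(B₁ , l₁), …] m lists, with repetitions, the unions X₁ ∪ … with Xᵢ ⊆ Bᵢ,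
  -- ∣ Xᵢ ∣ ≤ lᵢ and Σ ∣ Xᵢ ∣ = m; innerCount counts them, and is innerSum with C(a, n) for aⁿ/n!.
  mutual
    selections : ∀ {n} → List (Subset n × ℕ) → ℕ → List (Subset n)
    selections []              zero    = ⊥ ∷ []
    selections []              (suc m) = []
    selections ((B , l) ∷ cls) m       = concat (map (selectionsWith B l cls m) (upTo (suc m)))

    selectionsWith : ∀ {n} → Subset n → ℕ → List (Subset n × ℕ) → ℕ → ℕ → List (Subset n)
    selectionsWith B l cls m k =
      if does (k ≤? l) ∧ does (k ≤? m)
      then cartesianProductWith _∪_ (subsetsOfSize B k) (selections cls (m ∸ k)) else []

  innerCount : List (ℕ × ℕ) → ℕ → ℕ
  innerCount []              zero    = 1
  innerCount []              (suc m) = 0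
  innerCount ((a , l) ∷ dat) m       =
    sum (map (λ k → if does (k ≤? l) ∧ does (k ≤? m) then (a C k) * innerCount dat (m ∸ k) else 0)
             (upTo (suc m)))

  length-selections : ∀ {n} (cls : List (Subset n × ℕ)) m →
                      length (selections cls m) ≡ innerCount (map (map₁ ∣_∣) cls) m
  length-selections []              zero    = refl
  length-selections []              (suc m) = refl
  length-selections ((B , l) ∷ cls) m       =
    trans (length-concat (map (selectionsWith B l cls m) (upTo (suc m))))
          (cong sum (trans (sym (map-∘ (upTo (suc m)))) (map-cong length-selectionsWith (upTo (suc m)))))
    where
    length-selectionsWith : ∀ k → length (selectionsWith B l cls m k) ≡
      (if does (k ≤? l) ∧ does (k ≤? m)
       then (∣ B ∣ C k) * innerCount (map (map₁ ∣_∣) cls) (m ∸ k) else 0)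
    length-selectionsWith k with does (k ≤? l) ∧ does (k ≤? m)
    ... | false = refl
    ... | true  = trans (length-cartesianProductWith _∪_ (subsetsOfSize B k) (selections cls (m ∸ k)))
                        (cong₂ _*_ (length-subsetsOfSize B k) (length-selections cls (m ∸ k)))

  Covers : ∀ {n} → List (Subset n × ℕ) → Subset n → Set
  Covers cls Y = ∀ {x} → x ∈ Y → Any (λ c → x ∈ proj₁ c) cls

  WithinQuota : ∀ {n} → List (Subset n × ℕ) → Subset n → Set
  WithinQuota cls Y = All (λ c → ∣ proj₁ c ∩ Y ∣ ≤ proj₂ c) cls

  WithinQuota-⊆ : ∀ {n} {cls : List (Subset n × ℕ)} {Y Z} → Z ⊆ Y →
                  WithinQuota cls Y → WithinQuota cls Z
  WithinQuota-⊆ Z⊆Y = All.map (λ {(B , _)} → ≤-trans (p⊆q⇒∣p∣≤∣q∣ (B∩Z⊆B∩Y B)))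
    where
    B∩Z⊆B∩Y : ∀ B → B ∩ _ ⊆ B ∩ _
    B∩Z⊆B∩Y B x∈ with x∈B , x∈Z ← x∈p∩q⁻ B _ x∈ = x∈p∩q⁺ (x∈B , Z⊆Y x∈Z)

  Covers-─ : ∀ {n} {B : Subset n} {l cls Y} → Covers ((B , l) ∷ cls) Y → Covers cls (Y ─ B)
  Covers-─ {B = B} {Y = Y} covers x∈Y─B with covers (p─q⊆p Y B x∈Y─B)
  ... | here x∈B      = contradiction x∈B (x∈p─q⇒x∉q Y B x∈Y─B)
  ... | there x∈later = x∈later

  ≤?∧≤?-true : ∀ {k l m} → k ≤ l → k ≤ m → does (k ≤? l) ∧ does (k ≤? m) ≡ true
  ≤?∧≤?-true {k} {l} {m} k≤l k≤m rewrite dec-true (k ≤? l) k≤l | dec-true (k ≤? m) k≤m = refl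

  ∈-selections : ∀ {n} (cls : List (Subset n × ℕ)) {Y} → Covers cls Y → WithinQuota cls Y →
                 Y ∈ₗ selections cls ∣ Y ∣
  ∈-selections {n} [] {Y} covers _ =
    subst (λ Z → Z ∈ₗ selections [] ∣ Z ∣) (sym (Empty-unique (λ (_ , x∈Y) → ¬Any[] (covers x∈Y))))
          (subst (λ m → ⊥ {n} ∈ₗ selections [] m) (sym (∣⊥∣≡0 n)) (here refl))
  ∈-selections ((B , l) ∷ cls) {Y} covers (∣B∩Y∣≤l ∷ quota) =
    ∈-concat⁺′ Y∈selectionsWith-k (∈-map⁺ (selectionsWith B l cls m) (∈-upTo⁺ (s≤s k≤m)))
    where
    m = ∣ Y ∣
    k = ∣ B ∩ Y ∣
    Z = Y ─ B
    product = cartesianProductWith _∪_ (subsetsOfSize B k) (selections cls (m ∸ k))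
    k≤m : k ≤ m
    k≤m = ∣p∩q∣≤∣q∣ B Y
    ∣Z∣≡m∸k : ∣ Z ∣ ≡ m ∸ k
    ∣Z∣≡m∸k = sym (trans (cong (_∸ k) (∣p∣≡∣q∩p∣+∣p─q∣ Y B)) (m+n∸m≡n k ∣ Z ∣))
    Z∈ : Z ∈ₗ selections cls (m ∸ k)
    Z∈ = subst (λ j → Z ∈ₗ selections cls j) ∣Z∣≡m∸k
               (∈-selections cls (Covers-─ covers) (WithinQuota-⊆ (p─q⊆p Y B) quota))
    Y∈product : Y ∈ₗ product
    Y∈product = subst (_∈ₗ product) (sym (p≡[q∩p]∪[p─q] Y B))
                      (∈-cartesianProductWith⁺ _∪_ (⊆⇒∈-subsetsOfSize (p∩q⊆p B Y)) Z∈)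
    Y∈selectionsWith-k : Y ∈ₗ selectionsWith B l cls m k
    Y∈selectionsWith-k =
      subst (λ b → Y ∈ₗ (if b then product else [])) (sym (≤?∧≤?-true ∣B∩Y∣≤l k≤m)) Y∈product

module NatToRational where

  open import Data.Nat as ℕ using (zero; suc; _^_; _!; _≤?_; z≤n)
  import Data.Nat.Properties as ℕ
  open import Data.Nat.ListAction using (sum)
  open import Data.Nat.Combinatorics using (_C_)
  open import Data.Nat.Coprimality using (1-coprimeTo) renaming (sym to coprime-sym)
  open import Data.Integer as ℤ using (ℤ; +_; +0; +[1+_]; -[1+_])
  import Data.Integer.Properties as ℤ
  open import Data.Integer.DivMod using (div-pos-is-/ℕ; n<s[n/ℕd]*d)
  open import Data.Rational as ℚ using (ℚ; mkℚ; _/_; 0ℚ; *≤*; NonNegative)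
  import Data.Rational.Properties as ℚ
  open import Data.Rational.Unnormalised as ℚᵘ using (mkℚᵘ)
  import Data.Rational.Unnormalised.Properties as ℚᵘ
  open import Data.Bool using (true; false; if_then_else_; _∧_)
  open import Data.List using ([]; _∷_; map; upTo)
  open import Relation.Binary.PropositionalEquality
  open import Relation.Nullary using (does; ¬_)
  open import Defs using (sumℚ; powFact; innerSum)
  open Binomial using (mCk*k!≤m^k)
  open Enumeration using (innerCount)

  fromℕ : ℕ → ℚ
  fromℕ n = + n / 1

  private
    fromℕ≡mkℚ : ∀ n → fromℕ n ≡ mkℚ (+ n) 0 (coprime-sym (1-coprimeTo n))
    fromℕ≡mkℚ n = ℚ.↥p/↧p≡p (mkℚ (+ n) 0 (coprime-sym (1-coprimeTo n)))

  fromℕ-homo-+ : ∀ m n → fromℕ (m ℕ.+ n) ≡ fromℕ m ℚ.+ fromℕ n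
  fromℕ-homo-+ m n rewrite fromℕ≡mkℚ m | fromℕ≡mkℚ n =
    sym (cong (_/ 1) (cong₂ ℤ._+_ (ℤ.*-identityʳ (+ m)) (ℤ.*-identityʳ (+ n))))

  fromℕ-homo-* : ∀ m n → fromℕ (m ℕ.* n) ≡ fromℕ m ℚ.* fromℕ n
  fromℕ-homo-* m n rewrite fromℕ≡mkℚ m | fromℕ≡mkℚ n = cong (_/ 1) (ℤ.pos-* m n)

  fromℕ-mono-≤ : ∀ {m n} → m ℕ.≤ n → fromℕ m ℚ.≤ fromℕ n
  fromℕ-mono-≤ {m} {n} m≤n rewrite fromℕ≡mkℚ m | fromℕ≡mkℚ n =
    *≤* (subst₂ ℤ._≤_ (sym (ℤ.*-identityʳ (+ m))) (sym (ℤ.*-identityʳ (+ n))) (ℤ.+≤+ m≤n))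

  fromℕ-cancel-≤ : ∀ {m n} → fromℕ m ℚ.≤ fromℕ n → m ℕ.≤ n
  fromℕ-cancel-≤ {m} {n} m≤n rewrite fromℕ≡mkℚ m | fromℕ≡mkℚ n with m≤n
  ... | *≤* m*1≤n*1 =
    ℤ.drop‿+≤+ (subst₂ ℤ._≤_ (ℤ.*-identityʳ (+ m)) (ℤ.*-identityʳ (+ n)) m*1≤n*1)

  fromℕ-nonNeg : ∀ n → NonNegative (fromℕ n)
  fromℕ-nonNeg n = ℚ.nonNegative (fromℕ-mono-≤ {0} {n} z≤n)

  fromℕ≤/ : ∀ m n d .{{_ : ℕ.NonZero d}} → m ℕ.* d ℕ.≤ n → fromℕ m ℚ.≤ + n / d
  fromℕ≤/ m n (suc d) m*d≤n rewrite fromℕ≡mkℚ m =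
    ℚ.toℚᵘ-cancel-≤ (ℚᵘ.≤-respʳ-≃ (ℚᵘ.≃-sym (ℚ.toℚᵘ-fromℚᵘ (mkℚᵘ (+ n) d)))
      (ℚᵘ.*≤* (subst₂ ℤ._≤_ (ℤ.pos-* m (suc d)) (sym (ℤ.*-identityʳ (+ n))) (ℤ.+≤+ m*d≤n))))

  fromℕ[C]≤powFact : ∀ a k → fromℕ (a C k) ℚ.≤ powFact a k
  fromℕ[C]≤powFact a k = fromℕ≤/ (a C k) (a ^ k) (k !) {{k ℕ.!≢0}} (mCk*k!≤m^k a k)

  *-mono-≤-nonNeg : ∀ {p q r s} → NonNegative p → NonNegative r →
                    p ℚ.≤ q → r ℚ.≤ s → p ℚ.* r ℚ.≤ q ℚ.* s
  *-mono-≤-nonNeg {p} {q} {r} p≥0 r≥0 p≤q r≤s =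
    ℚ.≤-trans (ℚ.*-monoʳ-≤-nonNeg r {{r≥0}} p≤q) (ℚ.*-monoˡ-≤-nonNeg q {{q≥0}} r≤s)
    where
    q≥0 = ℚ.nonNegative (ℚ.≤-trans (ℚ.nonNegative⁻¹ p {{p≥0}}) p≤q)

  fromℕ[*]≤* : ∀ m n {r s} → fromℕ m ℚ.≤ r → fromℕ n ℚ.≤ s → fromℕ (m ℕ.* n) ℚ.≤ r ℚ.* s
  fromℕ[*]≤* m n m≤r n≤s = subst (ℚ._≤ _) (sym (fromℕ-homo-* m n))
                                 (*-mono-≤-nonNeg (fromℕ-nonNeg m) (fromℕ-nonNeg n) m≤r n≤s)

  fromℕ[if]≤if : ∀ b n {r} → fromℕ n ℚ.≤ r →
                 fromℕ (if b then n else 0) ℚ.≤ (if b then r else 0ℚ)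
  fromℕ[if]≤if true  _ n≤r = n≤r
  fromℕ[if]≤if false _ _   = ℚ.≤-refl

  fromℕ[sum]≤sumℚ : ∀ {A : Set} (f : A → ℕ) {g : A → ℚ} → (∀ a → fromℕ (f a) ℚ.≤ g a) →
                    ∀ xs → fromℕ (sum (map f xs)) ℚ.≤ sumℚ (map g xs)
  fromℕ[sum]≤sumℚ f f≤g []       = ℚ.≤-refl
  fromℕ[sum]≤sumℚ f f≤g (x ∷ xs) =
    subst (ℚ._≤ _) (sym (fromℕ-homo-+ (f x) (sum (map f xs))))
          (ℚ.+-mono-≤ (f≤g x) (fromℕ[sum]≤sumℚ f f≤g xs))

  innerCount≤innerSum : ∀ dat m → fromℕ (innerCount dat m) ℚ.≤ innerSum dat m
  innerCount≤innerSum []              zero    = ℚ.≤-refl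
  innerCount≤innerSum []              (suc m) = ℚ.≤-refl
  innerCount≤innerSum ((a , l) ∷ dat) m       = fromℕ[sum]≤sumℚ count term≤term (upTo (suc m))
    where
    count : ℕ → ℕ
    count k = if does (k ≤? l) ∧ does (k ≤? m) then (a C k) ℕ.* innerCount dat (m ℕ.∸ k) else 0
    term≤term : ∀ k → fromℕ (count k) ℚ.≤
                      (if does (k ≤? l) ∧ does (k ≤? m)
                       then powFact a k ℚ.* innerSum dat (m ℕ.∸ k) else 0ℚ)
    term≤term k = fromℕ[if]≤if (does (k ≤? l) ∧ does (k ≤? m)) _
                    (fromℕ[*]≤* (a C k) (innerCount dat (m ℕ.∸ k))
                                (fromℕ[C]≤powFact a k) (innerCount≤innerSum dat (m ℕ.∸ k)))

  private
    -[-n/d]≤x : ∀ n d x → n ℤ.* + 1 ℤ.≤ + x ℤ.* + suc d → ℤ.- ((ℤ.- n) ℤ./ + suc d) ℤ.≤ + x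
    -[-n/d]≤x n d x n≤x*d = ℤ.≮⇒≥ x<-f
      where
      f = (ℤ.- n) ℤ./ + suc d
      x<-f : ¬ (+ x ℤ.< ℤ.- f)
      x<-f x<-f = ℤ.≤⇒≯ (subst (ℤ._≤ _) (ℤ.*-identityʳ n) n≤x*d) x*d<n
        where
        f<-x : f ℤ.< ℤ.- + x
        f<-x = subst (ℤ._< ℤ.- + x) (ℤ.neg-involutive f) (ℤ.neg-mono-< x<-f)
        -n<[1+f]*d : ℤ.- n ℤ.< ℤ.suc f ℤ.* + suc d
        -n<[1+f]*d = subst (λ z → ℤ.- n ℤ.< ℤ.suc z ℤ.* + suc d) (sym (div-pos-is-/ℕ (ℤ.- n) (suc d)))
                           (n<s[n/ℕd]*d (ℤ.- n) (suc d))
        [1+f]*d≤-x*d : ℤ.suc f ℤ.* + suc d ℤ.≤ ℤ.- + x ℤ.* + suc d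
        [1+f]*d≤-x*d = ℤ.*-monoʳ-≤-nonNeg (+ suc d) (ℤ.i<j⇒suc[i]≤j f<-x)
        x*d<n : + x ℤ.* + suc d ℤ.< n
        x*d<n = ℤ.neg-cancel-< (subst (ℤ.- n ℤ.<_) (sym (ℤ.neg-distribˡ-* (+ x) (+ suc d)))
                                      (ℤ.<-≤-trans -n<[1+f]*d [1+f]*d≤-x*d))

  -- ℚ.ceiling only computes once the sign of the numerator is known.
  ceiling-least : ∀ {q} x → q ℚ.≤ fromℕ x → ℚ.ceiling q ℤ.≤ + x
  ceiling-least {q} x q≤x rewrite fromℕ≡mkℚ x with q | q≤x
  ... | mkℚ +0       d _ | *≤* n≤x*d = -[-n/d]≤x +0       d x n≤x*d
  ... | mkℚ +[1+ n ] d _ | *≤* n≤x*d = -[-n/d]≤x +[1+ n ] d x n≤x*d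
  ... | mkℚ -[1+ n ] d _ | *≤* n≤x*d = -[-n/d]≤x -[1+ n ] d x n≤x*d

module Counting where

  open import Data.Nat using (_+_; _<_; z≤n; s≤s)
  open import Data.Nat.Properties
  open import Data.List using (List; []; _∷_; map; filter; length; allFin)
  open import Data.List.Properties using (length-map; length-tabulate; filter-notAll; filter-all)
  open import Data.List.Membership.Propositional using () renaming (_∈_ to _∈ₗ_)
  open import Data.List.Membership.Propositional.Properties using (∈-filter⁺)
  open import Data.List.Relation.Unary.Any as Any using (here; there; satisfied)
  open import Data.Nat.ListAction using (sum)
  open import Data.List.Relation.Unary.All as All using (All; []; _∷_; all?)
  open import Data.List.Relation.Unary.All.Properties using (¬All⇒Any¬; all-filter; map⁺)
  open import Data.List.Relation.Unary.Unique.Propositional using (Unique)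
  open import Data.List.Relation.Unary.AllPairs using (_∷_)
  import Data.List.Relation.Unary.Unique.Propositional.Properties as Unique
  open import Data.Product using (uncurry)
  open import Relation.Binary using (DecidableEquality)
  open import Relation.Binary.PropositionalEquality
  open import Relation.Nullary using (¬_; ¬?; yes; no; contradiction)
  open import Relation.Nullary.Decidable using (_⊎-dec_)
  open import Relation.Unary using (Decidable)

  length-allFin : ∀ n → length (allFin n) ≡ n
  length-allFin n = length-tabulate {n = n} (λ i → i)

  Unique⇒length-≤ : ∀ {A : Set} → DecidableEquality A → {xs ys : List A} →
                    Unique xs → All (_∈ₗ ys) xs → length xs ≤ length ys
  Unique⇒length-≤ _≟_ {[]}     _              _             = z≤n
  Unique⇒length-≤ _≟_ {x ∷ xs} {ys} (x∉xs ∷ xs!) (x∈ys ∷ xs⊆ys) =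
    ≤-trans (s≤s (Unique⇒length-≤ _≟_ xs! (All.zipWith (uncurry move) (x∉xs , xs⊆ys))))
            (filter-notAll (λ y → ¬? (y ≟ x)) ys (Any.map (λ x≡y x≢y → x≢y (sym x≡y)) x∈ys))
    where
    move : ∀ {z} → ¬ x ≡ z → z ∈ₗ ys → z ∈ₗ filter (λ y → ¬? (y ≟ x)) ys
    move x≢z z∈ys = ∈-filter⁺ _ z∈ys (λ z≡x → x≢z (sym z≡x))

  ∈⇒≤sum : ∀ {n ns} → n ∈ₗ ns → n ≤ sum ns
  ∈⇒≤sum (here refl)                = m≤m+n _ _
  ∈⇒≤sum {ns = m ∷ _} (there n∈ns) = ≤-trans (∈⇒≤sum n∈ns) (m≤n+m _ m)

  sum-map-mono-≤ : ∀ {A : Set} {f g : A → ℕ} → (∀ a → f a ≤ g a) →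
                   ∀ xs → sum (map f xs) ≤ sum (map g xs)
  sum-map-mono-≤ f≤g []       = z≤n
  sum-map-mono-≤ f≤g (x ∷ xs) = +-mono-≤ (f≤g x) (sum-map-mono-≤ f≤g xs)

  module _ {A : Set} {P : A → Set} (P? : Decidable P) where

    count-⊎ : ∀ {Q : A → Set} (Q? : Decidable Q) xs →
              length (filter (λ x → P? x ⊎-dec Q? x) xs) ≤ length (filter P? xs) + length (filter Q? xs)
    count-⊎ Q? []       = z≤n
    count-⊎ Q? (x ∷ xs) with P? x | Q? x
    ... | yes _ | yes _ = s≤s (≤-trans (count-⊎ Q? xs) (+-monoʳ-≤ _ (n≤1+n _)))
    ... | yes _ | no  _ = s≤s (count-⊎ Q? xs)
    ... | no  _ | yes _ = ≤-trans (s≤s (count-⊎ Q? xs)) (≤-reflexive (sym (+-suc _ _)))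
    ... | no  _ | no  _ = count-⊎ Q? xs

  module _ {n} {P : Fin n → Set} (P? : Decidable P) where

    count-injection : ∀ {B : Set} → DecidableEquality B → (f : Fin n → B) → Injective _≡_ _≡_ f →
                      ∀ ys → (∀ {i} → P i → f i ∈ₗ ys) → length (filter P? (allFin n)) ≤ length ys
    count-injection _≟_ f f-injective ys P⇒f∈ys =
      ≤-trans (≤-reflexive (sym (length-map f (filter P? (allFin n)))))
              (Unique⇒length-≤ _≟_ (Unique.map⁺ f-injective (Unique.filter⁺ P? (Unique.allFin⁺ n)))
                                    (map⁺ (All.map P⇒f∈ys (all-filter P? (allFin n)))))

    count<n⇒∃¬ : length (filter P? (allFin n)) < n → ∃ λ i → ¬ P i
    count<n⇒∃¬ count<n with all? P? (allFin n)
    ... | yes all-P = contradiction (trans (cong length (filter-all P? all-P)) (length-allFin n)) (<⇒≢ count<n)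
    ... | no ¬all-P = satisfied (¬All⇒Any¬ P? (allFin n) ¬all-P)

module CandidateCount where

  open import Data.Nat using (suc; _+_; _*_; _∸_)
  open import Data.Nat.Properties
    using (≤-trans; n<1+n; n∸n≡0; *-identityʳ; +-identityʳ; +-monoˡ-≤; module ≤-Reasoning)
  open import Data.Nat.ListAction using (sum)
  open import Data.Nat.Combinatorics using (_C_)
  open import Data.Integer as ℤ using (ℤ; +_)
  open import Data.Rational as ℚ using (ℚ; 0ℚ; 1ℚ)
  import Data.Rational.Properties as ℚ
  open import Data.Bool using (if_then_else_)
  open import Data.List using (List; []; _∷_; map; upTo)
  open import Data.List.Membership.Propositional.Properties using (∈-map⁺; ∈-upTo⁺)
  open import Relation.Binary.PropositionalEquality
  open import Relation.Nullary using (does)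
  open import Relation.Nullary.Decidable using (dec-true)
  open import Defs using (bound; powFact; innerSum; sumℚ)
  open Binomial using (w≤[p*w]Cp)
  open Enumeration using (innerCount)
  open NatToRational
  open Counting using (∈⇒≤sum)

  candidateCountAt : ℕ → ℤ → ℕ → List (ℕ × ℕ) → ℕ → ℕ
  candidateCountAt p θ m dat ω = if does (θ ℤ.≤? + ω) then (m C ω) * innerCount dat (p ∸ ω) else 0

  candidateCount : ℕ → ℤ → ℕ → List (ℕ × ℕ) → ℕ
  candidateCount p θ m dat = sum (map (candidateCountAt p θ m dat) (upTo (suc p)))

  innerCount-0 : ∀ dat → innerCount dat 0 ≡ 1
  innerCount-0 []              = refl
  innerCount-0 ((a , l) ∷ dat) rewrite innerCount-0 dat = refl

  w≤candidateCount : ∀ {p θ} w dat → 1 ≤ p → θ ℤ.≤ + p → w ≤ candidateCount p θ (p * w) dat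
  w≤candidateCount {p} {θ} w dat 1≤p θ≤p =
    ≤-trans w≤term (∈⇒≤sum (∈-map⁺ (candidateCountAt p θ (p * w) dat) (∈-upTo⁺ (n<1+n p))))
    where
    w≤term : w ≤ candidateCountAt p θ (p * w) dat p
    w≤term rewrite dec-true (θ ℤ.≤? + p) θ≤p | n∸n≡0 p | innerCount-0 dat | *-identityʳ ((p * w) C p) =
      w≤[p*w]Cp p w 1≤p

  2*candidateCount≤q : ∀ {p w ζ q} dat → bound p w ζ dat ℚ.≤ fromℕ q →
                   2 * candidateCount p (ℚ.ceiling (ζ ℚ.* fromℕ p)) (p * w) dat ≤ q
  2*candidateCount≤q {p} {w} {ζ} {q} dat bound≤q = fromℕ-cancel-≤ (begin
    fromℕ (2 * M)           ≡⟨ fromℕ-homo-* 2 M ⟩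
    fromℕ 2 ℚ.* fromℕ M     ≤⟨ ℚ.*-monoˡ-≤-nonNeg (fromℕ 2) {{fromℕ-nonNeg 2}} M≤sum ⟩
    bound p w ζ dat         ≤⟨ bound≤q ⟩
    fromℕ q                 ∎)
    where
    open ℚ.≤-Reasoning
    θ = ℚ.ceiling (ζ ℚ.* fromℕ p)
    M = candidateCount p θ (p * w) dat
    termℚ : ℕ → ℚ
    termℚ ω = if does (θ ℤ.≤? + ω) then powFact (p * w) ω ℚ.* innerSum dat (p ∸ ω) else 0ℚ
    M≤sum : fromℕ M ℚ.≤ sumℚ (map termℚ (upTo (suc p)))
    M≤sum = fromℕ[sum]≤sumℚ (candidateCountAt p θ (p * w) dat)
      (λ ω → fromℕ[if]≤if (does (θ ℤ.≤? + ω)) _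
               (fromℕ[*]≤* ((p * w) C ω) _ (fromℕ[C]≤powFact (p * w) ω)
                                           (innerCount≤innerSum dat (p ∸ ω))))
      (upTo (suc p))

  w+candidateCount≤q : ∀ {p w ζ q} dat → 1 ≤ p → ζ ℚ.≤ 1ℚ → bound p w ζ dat ℚ.≤ fromℕ q →
                   w + candidateCount p (ℚ.ceiling (ζ ℚ.* fromℕ p)) (p * w) dat ≤ q
  w+candidateCount≤q {p} {w} {ζ} {q} dat 1≤p ζ≤1 bound≤q = begin
    w + M      ≤⟨ +-monoˡ-≤ M (w≤candidateCount w dat 1≤p (ceiling-least p ζp≤p)) ⟩
    M + M      ≡⟨ cong (λ n → M + n) (+-identityʳ M) ⟨
    2 * M      ≤⟨ 2*candidateCount≤q {p} {w} {ζ} dat bound≤q ⟩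
    q          ∎
    where
    open ≤-Reasoning
    M = candidateCount p (ℚ.ceiling (ζ ℚ.* fromℕ p)) (p * w) dat
    ζp≤p : ζ ℚ.* fromℕ p ℚ.≤ fromℕ p
    ζp≤p = ℚ.≤-trans (ℚ.*-monoʳ-≤-nonNeg (fromℕ p) {{fromℕ-nonNeg p}} ζ≤1)
                     (ℚ.≤-reflexive (ℚ.*-identityˡ (fromℕ p)))

module HeavySets {p N ρ : ℕ} (A : Fin p → Subset N) (Astar : Fin ρ → Subset N)
                 (equal-or-disjoint : ∀ j j′ → A j ≡ A j′ ⊎ A j ∩ A j′ ≡ ⊥)
                 (A-is-class : ∀ j → ∃ λ i → A j ≡ Astar i)
                 (class-is-A : ∀ i → ∃ λ j → Astar i ≡ A j) where

  open import Data.Nat using (_∸_; _*_; suc; z≤n; s≤s)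
  open import Data.Nat.Properties
  open import Data.Nat.ListAction using (sum)
  open import Data.Nat.Combinatorics using (_C_)
  open import Data.Bool using (true; false; if_then_else_)
  open import Data.Fin.Subset using (_⊆_; _∪_; _─_; ⋃; ⁅_⁆)
  open import Data.Sum using (inj₁; inj₂)
  open import Relation.Binary.PropositionalEquality
  open import Data.Fin.Subset.Properties
    using (x∈p∩q⁺; x∈p∩q⁻; p⊆q⇒∣p∣≤∣q∣; ∣p∩q∣≤∣q∣; p─q⊆p; p∩q⊆p; x∈⁅x⁆; ∣⁅x⁆∣≡1; ∉⊥)
  open import Data.Integer as ℤ using (ℤ; +_)
  open import Data.List
    using (List; []; map; filter; length; concat; cartesianProductWith; upTo; allFin)
  open import Data.List.Properties using (map-∘)
  open import Data.List.Membership.Propositional using () renaming (_∈_ to _∈ₗ_)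
  open import Data.List.Membership.Propositional.Properties
    using (∈-map⁺; ∈-filter⁺; ∈-allFin; ∈-concat⁺′; ∈-cartesianProductWith⁺; ∈-upTo⁺)
  open import Data.List.Relation.Unary.Any as Any using ()
  open import Data.List.Relation.Unary.Any.Properties using () renaming (map⁺ to Any-map⁺)
  open import Data.List.Relation.Unary.All as All using ()
  open import Data.List.Relation.Unary.All.Properties using () renaming (map⁺ to All-map⁺)
  open import Data.Product using (map₁)
  open import Relation.Nullary using (does; contradiction)
  open import Relation.Nullary.Decidable using (dec-true)
  open import Relation.Unary using (Decidable)
  open import Defs using (_≟ₛ_; occurrences; image; distinctData)
  open Subsets
  open Enumeration
  open CandidateCount using (candidateCountAt; candidateCount)
  open Binomial using (C-monoˡ-≤)
  open Counting using (sum-map-mono-≤; count-injection)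

  classes : List (Subset N × ℕ)
  classes = map (λ i → Astar i , occurrences A (Astar i)) (allFin ρ)

  module _ {t : Fin p → Fin N} (t∈A : ∀ j → t j ∈ A j) where

    image-Covers : Covers classes (image t)
    image-Covers x∈image with j , refl ← ∈-image⁻ {t = t} x∈image
                         with i , Aj≡Astar-i ← A-is-class j =
      Any-map⁺ (Any.map (λ {refl → subst (t j ∈_) Aj≡Astar-i (t∈A j)}) (∈-allFin i))

    ∣A∩image∣≤occurrences : ∀ j′ → ∣ A j′ ∩ image t ∣ ≤ occurrences A (A j′)
    ∣A∩image∣≤occurrences j′ = begin
      ∣ A j′ ∩ image t ∣          ≤⟨ p⊆q⇒∣p∣≤∣q∣ ⊆⋃singletons ⟩
      ∣ ⋃ (map (⁅_⁆ ∘ t) same) ∣  ≤⟨ ∣⋃map∣≤length* (⁅_⁆ ∘ t) (≤-reflexive ∘ ∣⁅x⁆∣≡1 ∘ t) same ⟩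
      length same * 1             ≡⟨ *-identityʳ (length same) ⟩
      occurrences A (A j′)        ∎
      where
      open ≤-Reasoning
      same = filter (λ j → A j ≟ₛ A j′) (allFin p)
      ⊆⋃singletons : A j′ ∩ image t ⊆ ⋃ (map (⁅_⁆ ∘ t) same)
      ⊆⋃singletons x∈ with x∈Aj′ , x∈image ← x∈p∩q⁻ (A j′) _ x∈
                         with j , refl ← ∈-image⁻ {t = t} x∈image
                         with equal-or-disjoint j j′
      ... | inj₁ Aj≡Aj′   =
        x∈⋃⁺ (∈-map⁺ (⁅_⁆ ∘ t) (∈-filter⁺ _ (∈-allFin j) Aj≡Aj′)) (x∈⁅x⁆ (t j))
      ... | inj₂ Aj∩Aj′≡⊥ =
        contradiction (subst (t j ∈_) Aj∩Aj′≡⊥ (x∈p∩q⁺ (t∈A j , x∈Aj′))) ∉⊥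

    image-WithinQuota : WithinQuota classes (image t)
    image-WithinQuota = All-map⁺ (All.tabulate λ {i} _ →
      let j′ , Astar-i≡Aj′ = class-is-A i
      in subst (λ B → ∣ B ∩ image t ∣ ≤ occurrences A B) (sym Astar-i≡Aj′)
               (∣A∩image∣≤occurrences j′))

  candidatesAt : ℤ → Subset N → ℕ → List (Subset N)
  candidatesAt θ U ω =
    if does (θ ℤ.≤? + ω)
    then cartesianProductWith _∪_ (subsetsOfSize U ω) (selections classes (p ∸ ω)) else []

  candidates : ℤ → Subset N → List (Subset N)
  candidates θ U = concat (map (candidatesAt θ U) (upTo (suc p)))

  heavy⇒∈candidates : ∀ {θ U} {t : Fin p → Fin N} → (∀ j → t j ∈ A j) → ∣ image t ∣ ≡ p →
                      θ ℤ.≤ + ∣ U ∩ image t ∣ → image t ∈ₗ candidates θ U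
  heavy⇒∈candidates {θ} {U} {t} t∈A ∣S∣≡p θ≤ω =
    ∈-concat⁺′ S∈candidatesAt-ω (∈-map⁺ (candidatesAt θ U) (∈-upTo⁺ (s≤s ω≤p)))
    where
    S = image t
    ω = ∣ U ∩ S ∣
    Z = S ─ U
    product = cartesianProductWith _∪_ (subsetsOfSize U ω) (selections classes (p ∸ ω))
    ω≤p : ω ≤ p
    ω≤p = subst (ω ≤_) ∣S∣≡p (∣p∩q∣≤∣q∣ U S)
    ∣Z∣≡p∸ω : ∣ Z ∣ ≡ p ∸ ω
    ∣Z∣≡p∸ω = sym (trans (cong (_∸ ω) (trans (sym ∣S∣≡p) (∣p∣≡∣q∩p∣+∣p─q∣ S U)))
                         (m+n∸m≡n ω ∣ Z ∣))
    Z∈ : Z ∈ₗ selections classes (p ∸ ω)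
    Z∈ = subst (λ m → Z ∈ₗ selections classes m) ∣Z∣≡p∸ω
               (∈-selections classes (image-Covers t∈A ∘ p─q⊆p S U)
                                     (WithinQuota-⊆ (p─q⊆p S U) (image-WithinQuota t∈A)))
    S∈product : S ∈ₗ product
    S∈product = subst (_∈ₗ product) (sym (p≡[q∩p]∪[p─q] S U))
                      (∈-cartesianProductWith⁺ _∪_ (⊆⇒∈-subsetsOfSize (p∩q⊆p U S)) Z∈)
    S∈candidatesAt-ω : S ∈ₗ candidatesAt θ U ω
    S∈candidatesAt-ω =
      subst (λ b → S ∈ₗ (if b then product else [])) (sym (dec-true (θ ℤ.≤? + ω) θ≤ω)) S∈product

  length-candidates : ∀ θ {U m} → ∣ U ∣ ≤ m →
                      length (candidates θ U) ≤ candidateCount p θ m (distinctData A Astar)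
  length-candidates θ {U} {m} ∣U∣≤m = begin
    length (candidates θ U)                       ≡⟨ length-concat (map (candidatesAt θ U) ωs) ⟩
    sum (map length (map (candidatesAt θ U) ωs))  ≡⟨ cong sum (map-∘ ωs) ⟨
    sum (map (length ∘ candidatesAt θ U) ωs)      ≤⟨ sum-map-mono-≤ length-candidatesAt≤ ωs ⟩
    candidateCount p θ m (distinctData A Astar)   ∎
    where
    open ≤-Reasoning
    ωs = upTo (suc p)
    classes-data : map (map₁ ∣_∣) classes ≡ distinctData A Astar
    classes-data = sym (map-∘ (allFin ρ))
    length-candidatesAt≤ : ∀ ω → length (candidatesAt θ U ω) ≤
                                 candidateCountAt p θ m (distinctData A Astar) ω
    length-candidatesAt≤ ω with does (θ ℤ.≤? + ω)
    ... | false = z≤n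
    ... | true  = begin
      length (cartesianProductWith _∪_ (subsetsOfSize U ω) (selections classes (p ∸ ω)))
        ≡⟨ length-cartesianProductWith _∪_ (subsetsOfSize U ω) (selections classes (p ∸ ω)) ⟩
      length (subsetsOfSize U ω) * length (selections classes (p ∸ ω))
        ≡⟨ cong₂ _*_ (length-subsetsOfSize U ω)
                     (trans (length-selections classes (p ∸ ω))
                            (cong (λ dat → innerCount dat (p ∸ ω)) classes-data)) ⟩
      (∣ U ∣ C ω) * innerCount (distinctData A Astar) (p ∸ ω)
        ≤⟨ *-monoˡ-≤ _ (C-monoˡ-≤ ω ∣U∣≤m) ⟩
      (m C ω) * innerCount (distinctData A Astar) (p ∸ ω)
        ∎

  module _ {q} {s : Fin q → Fin p → Fin N} (s∈A : ∀ i j → s i j ∈ A j)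
           (∣image∣≡p : ∀ i → ∣ image (s i) ∣ ≡ p)
           (image-injective : ∀ i i′ → image (s i) ≡ image (s i′) → i ≡ i′) where

    count-heavy : ∀ {θ U m} {Heavy : Fin q → Set} (heavy? : Decidable Heavy) →
                  (∀ {i} → Heavy i → θ ℤ.≤ + ∣ U ∩ image (s i) ∣) → ∣ U ∣ ≤ m →
                  length (filter heavy? (allFin q)) ≤ candidateCount p θ m (distinctData A Astar)
    count-heavy {θ} {U} {Heavy = Heavy} heavy? heavy⇒θ≤ ∣U∣≤m =
      ≤-trans (count-injection heavy? _≟ₛ_ (image ∘ s) (image-injective _ _) (candidates θ U) heavy⇒∈)
              (length-candidates θ {U} ∣U∣≤m)
      where
      heavy⇒∈ : ∀ {i} → Heavy i → image (s i) ∈ₗ candidates θ U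
      heavy⇒∈ {i} heavy-i = heavy⇒∈candidates {U = U} (s∈A i) (∣image∣≡p i) (heavy⇒θ≤ heavy-i)

module Greedy where

  open import Data.Nat using (zero; suc; _+_; _*_; _<_; _<?_; _≟_; s≤s⁻¹)
  open import Data.Nat.Properties
  open import Data.Fin using (fromℕ<)
  import Data.Fin
  open import Data.Fin.Properties using (toℕ-injective; toℕ-fromℕ<; toℕ<n)
  open import Data.Fin.Subset using (⋃)
  open import Data.List using (List; map; filter; length; allFin)
  open import Data.List.Properties using (length-map; filter-notAll; map-cong-local)
  open import Data.List.Membership.Propositional using () renaming (_∈_ to _∈ₗ_; _∉_ to _∉ₗ_)
  open import Data.List.Membership.Propositional.Properties using (∈-map⁺; ∈-filter⁺; ∈-allFin)
  import Data.List.Membership.DecPropositional as DecMembership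
  open import Data.List.Relation.Unary.Any as Any using ()
  open import Data.List.Relation.Unary.All as All using ()
  open import Data.List.Relation.Unary.All.Properties using (all-filter)
  open import Data.Product using (proj₁; proj₂)
  open import Data.Sum using (inj₁; inj₂)
  open import Relation.Binary.PropositionalEquality
  open import Relation.Nullary using (Dec; yes; no; ¬?; contradiction)
  open import Relation.Nullary.Decidable using (decidable-stable; _⊎-dec_)
  open import Defs using (prefixUnion)
  open Subsets using (∣⋃map∣≤length*)
  open Counting using (count-⊎; count-injection; count<n⇒∃¬; length-allFin)

  earlier : ∀ {w} → Fin w → List (Fin w)
  earlier l = filter (λ i → toℕ i <? toℕ l) (allFin _)

  length-earlier<w : ∀ {w} (l : Fin w) → length (earlier l) < w
  length-earlier<w {w} l = subst (length (earlier l) <_) (length-allFin w)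
    (filter-notAll (λ i → toℕ i <? toℕ l) (allFin w) (Any.map (λ { refl → n≮n (toℕ l) }) (∈-allFin l)))

  ∈-earlier : ∀ {w} {i l : Fin w} → toℕ i < toℕ l → i ∈ₗ earlier l
  ∈-earlier {i = i} i<l = ∈-filter⁺ _ (∈-allFin i) i<l

  prefixUnion-cong : ∀ {w N} {F G : Fin w → Subset N} l → (∀ {i} → toℕ i < toℕ l → F i ≡ G i) →
                     prefixUnion F l ≡ prefixUnion G l
  prefixUnion-cong l F≡G =
    cong ⋃ (map-cong-local (All.map F≡G (all-filter (λ i → toℕ i <? toℕ l) (allFin _))))

  module _ {q : ℕ} where

    assign : ∀ {w} → ℕ → Fin q → (Fin w → Fin q) → Fin w → Fin q
    assign k c g i with toℕ i ≟ k
    ... | yes _ = c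
    ... | no  _ = g i

    assign-≢ : ∀ {w k c g} {i : Fin w} → toℕ i ≢ k → assign k c g i ≡ g i
    assign-≢ {k = k} {i = i} i≢k with toℕ i ≟ k
    ... | yes i≡k = contradiction i≡k i≢k
    ... | no  _   = refl

  module _ {N q : ℕ} (T : Fin q → Subset N) (Good : Subset N → Fin q → Set)
           (good? : ∀ U i → Dec (Good U i)) where

    record Valid {w} (k : ℕ) (g : Fin w → Fin q) : Set where
      field
        injective : ∀ {i j} → toℕ i < k → toℕ j < k → g i ≡ g j → i ≡ j
        good      : ∀ {l} → toℕ l < k → Good (prefixUnion (T ∘ g) l) (g l)

    extend : ∀ {w k} (k<w : k < w) {g : Fin w → Fin q} → Valid k g → ∀ {c} →
             c ∉ₗ map g (earlier (fromℕ< k<w)) → Good (prefixUnion (T ∘ g) (fromℕ< k<w)) c →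
             Valid (suc k) (assign k c g)
    extend {w} {k} k<w {g} valid {c} fresh good-c = record { injective = injective′ ; good = good′ }
      where
      open Valid valid
      g′ = assign k c g
      κ = fromℕ< k<w
      κ≤k : toℕ κ ≤ k
      κ≤k = ≤-reflexive (toℕ-fromℕ< k<w)

      ≤k⇒same-prefix : ∀ {l} → toℕ l ≤ k → prefixUnion (T ∘ g′) l ≡ prefixUnion (T ∘ g) l
      ≤k⇒same-prefix l≤k = prefixUnion-cong _ (λ i<l → cong T (assign-≢ (<⇒≢ (<-≤-trans i<l l≤k))))

      <k⇒taken : ∀ {i} → toℕ i < k → g i ∈ₗ map g (earlier κ)
      <k⇒taken i<k = ∈-map⁺ g (∈-earlier (subst (_ <_) (sym (toℕ-fromℕ< k<w)) i<k))

      good′ : ∀ {l} → toℕ l < suc k → Good (prefixUnion (T ∘ g′) l) (g′ l)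
      <1+k∧≢k : ∀ {n} → n < suc k → n ≢ k → n < k
      <1+k∧≢k n<1+k n≢k = ≤∧≢⇒< (s≤s⁻¹ n<1+k) n≢k

      good′ {l} l<1+k with toℕ l ≟ k
      ... | yes l≡k = subst (λ l → Good (prefixUnion (T ∘ g′) l) c)
                            (toℕ-injective (trans (toℕ-fromℕ< k<w) (sym l≡k)))
                            (subst (λ U → Good U c) (sym (≤k⇒same-prefix κ≤k)) good-c)
      ... | no  l≢k = subst (λ U → Good U (g l)) (sym (≤k⇒same-prefix (s≤s⁻¹ l<1+k)))
                            (good (<1+k∧≢k l<1+k l≢k))

      injective′ : ∀ {i j} → toℕ i < suc k → toℕ j < suc k → g′ i ≡ g′ j → i ≡ j
      injective′ {i} {j} i<1+k j<1+k g′i≡g′j with toℕ i ≟ k | toℕ j ≟ k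
      ... | yes i≡k | yes j≡k = toℕ-injective (trans i≡k (sym j≡k))
      ... | yes _   | no  j≢k = contradiction (subst (_∈ₗ _) (sym g′i≡g′j) (<k⇒taken (<1+k∧≢k j<1+k j≢k))) fresh
      ... | no  i≢k | yes _   = contradiction (subst (_∈ₗ _) g′i≡g′j (<k⇒taken (<1+k∧≢k i<1+k i≢k))) fresh
      ... | no  i≢k | no  j≢k = injective (<1+k∧≢k i<1+k i≢k) (<1+k∧≢k j<1+k j≢k) g′i≡g′j

    module _ {w M p : ℕ} (∣T∣≤p : ∀ i → ∣ T i ∣ ≤ p)
             (few-bad : ∀ U → ∣ U ∣ ≤ p * w →
                        length (filter (λ i → ¬? (good? U i)) (allFin q)) ≤ M)
             (w+M≤q : w + M ≤ q) where

      fresh-good : ∀ (g : Fin w → Fin q) l →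
                   ∃ λ i → i ∉ₗ map g (earlier l) × Good (prefixUnion (T ∘ g) l) i
      fresh-good g l = i , ¬excluded ∘ inj₁ , decidable-stable (good? U i) (¬excluded ∘ inj₂)
        where
        open DecMembership Data.Fin._≟_ using (_∈?_)
        U = prefixUnion (T ∘ g) l
        taken = map g (earlier l)
        excluded? = λ i → (i ∈? taken) ⊎-dec ¬? (good? U i)
        ∣U∣≤p*w : ∣ U ∣ ≤ p * w
        ∣U∣≤p*w = begin
          ∣ U ∣                    ≤⟨ ∣⋃map∣≤length* (T ∘ g) (∣T∣≤p ∘ g) (earlier l) ⟩
          length (earlier l) * p   ≤⟨ *-monoˡ-≤ p (<⇒≤ (length-earlier<w l)) ⟩
          w * p                    ≡⟨ *-comm w p ⟩
          p * w                    ∎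
          where open ≤-Reasoning
        count-excluded<q : length (filter excluded? (allFin q)) < q
        count-excluded<q = begin-strict
          length (filter excluded? (allFin q))
            ≤⟨ count-⊎ (_∈? taken) (λ i → ¬? (good? U i)) (allFin q) ⟩
          length (filter (_∈? taken) (allFin q)) + length (filter (λ i → ¬? (good? U i)) (allFin q))
            ≤⟨ +-mono-≤ (count-injection (_∈? taken) Data.Fin._≟_ (λ i → i) (λ e → e) taken (λ i∈ → i∈))
                        (few-bad U ∣U∣≤p*w) ⟩
          length taken + M
            ≡⟨ cong (_+ M) (length-map g (earlier l)) ⟩
          length (earlier l) + M
            <⟨ +-monoˡ-< M (length-earlier<w l) ⟩
          w + M
            ≤⟨ w+M≤q ⟩
          q ∎
          where open ≤-Reasoning
        i = proj₁ (count<n⇒∃¬ excluded? count-excluded<q)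
        ¬excluded = proj₂ (count<n⇒∃¬ excluded? count-excluded<q)

      valid-prefix : ∀ k → k ≤ w → ∃ (Valid {w} k)
      valid-prefix zero    _   = arbitrary , record { injective = λ () ; good = λ () }
        where
        arbitrary : Fin w → Fin q
        arbitrary i = fromℕ< (<-≤-trans (toℕ<n i) (≤-trans (m≤m+n w M) w+M≤q))
      valid-prefix (suc k) k<w =
        let g , valid        = valid-prefix k (<⇒≤ k<w)
            i , fresh , good = fresh-good g (fromℕ< k<w)
        in  assign k i g , extend k<w valid fresh good

      greedy : ∃ λ (n : Fin w → Fin q) →
               Injective _≡_ _≡_ n × ∀ l → Good (prefixUnion (T ∘ n) l) (n l)
      greedy with n , valid ← valid-prefix w ≤-refl =
        n , injective (toℕ<n _) (toℕ<n _) , λ l → good (toℕ<n l)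
        where open Valid valid

open import Data.Integer using (+_)
open import Data.Rational using (ℚ; 0ℚ; 1ℚ; _/_; _*_) renaming (_≤_ to _≤ℚ_; _<_ to _<ℚ_)
import Data.Nat as ℕ
import Data.Nat.Properties as ℕ
import Data.Rational as ℚ
import Data.Rational.Properties as ℚ
open import Data.List using (filter; length; allFin)
open import Relation.Nullary using (Dec; ¬?)
open NatToRational using (ceiling-least)
open CandidateCount using (candidateCount; w+candidateCount≤q)
open Greedy using (greedy)

lemma24 : (p w : ℕ) → 2 ≤ p → 1 ≤ w → (ζ : ℚ) → 0ℚ <ℚ ζ → ζ ≤ℚ 1ℚ →
    (N : ℕ) (A : Fin p → Subset N) →
    (∀ j j′ → A j ≡ A j′ ⊎ A j ∩ A j′ ≡ ⊥) →
    (ρ : ℕ) (Astar : Fin ρ → Subset N) →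
    Injective _≡_ _≡_ Astar →
    (∀ j → ∃ λ i → A j ≡ Astar i) →
    (∀ i → ∃ λ j → Astar i ≡ A j) →
    (q : ℕ) (s : Fin q → Fin p → Fin N) →
    (∀ i → ∣ image (s i) ∣ ≡ p) →
    (∀ i j → s i j ∈ A j) →
    (∀ i i′ → image (s i) ≡ image (s i′) → i ≡ i′) →
    bound p w ζ (distinctData A Astar) ≤ℚ (+ q / 1) →
    ∃ λ (n : Fin w → Fin q) → Injective _≡_ _≡_ n ×
    (∀ l → 1 ≤ toℕ l →
    (+ ∣ prefixUnion (image ∘ s ∘ n) l ∩ image (s (n l)) ∣ / 1) ≤ℚ ζ * (+ p / 1))
lemma24 p w 2≤p _ ζ _ ζ≤1 N A equal-or-disjoint ρ Astar _ A-is-class class-is-A q s ∣image∣≡p s∈A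
        image-injective bound≤q =
  let n , n-injective , sparse = greedy (image ∘ s) Sparse sparse? (ℕ.≤-reflexive ∘ ∣image∣≡p)
                                        few-dense w+M≤q
  in  n , n-injective , λ l _ → sparse l
  where
  open HeavySets A Astar equal-or-disjoint A-is-class class-is-A using (count-heavy)
  θ = ℚ.ceiling (ζ * (+ p / 1))
  M = candidateCount p θ (p ℕ.* w) (distinctData A Astar)
  Sparse : Subset N → Fin q → Set
  Sparse U i = (+ ∣ U ∩ image (s i) ∣ / 1) ≤ℚ ζ * (+ p / 1)
  sparse? : ∀ U i → Dec (Sparse U i)
  sparse? U i = _ ℚ.≤? _
  few-dense : ∀ U → ∣ U ∣ ≤ p ℕ.* w → length (filter (λ i → ¬? (sparse? U i)) (allFin q)) ≤ M
  few-dense U = count-heavy s∈A ∣image∣≡p image-injective {U = U} (λ i → ¬? (sparse? U i))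
                            (λ dense → ceiling-least _ (ℚ.<⇒≤ (ℚ.≰⇒> dense)))
  w+M≤q : w ℕ.+ M ≤ q
  w+M≤q = w+candidateCount≤q (distinctData A Astar) (ℕ.<⇒≤ 2≤p) ζ≤1 bound≤q
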